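{- Let $H$ be a finite hypergraph and let $M_H$ be a unit-compatible matrix. For any unit $W_E\in\mathfrak{U}(H)$ with $|W_E|>1$, the number $d_{M_H}(W_E)-r_{M_H}(W_E)$ is an eigenvalue of $M_H$ whose eigenspace has dimension at least $|W_E|-1$.
   Context: A hypergraph $H$ is a pair $(V(H),E(H))$ with $V(H)$ a nonempty finite set and $E(H)$ a set of nonempty subsets of $V(H)$. For $v\in V(H)$, its star is $E_v(H)=\{e\in E(H):v\in e\}$. A unit of $H$ is an equivalence class of the relation $u\sim v\iff E_u(H)=E_v(H)$; the unit whose vertices all have star $E$ is denoted $W_E$, and $\mathfrak{U}(H)$ is the set of units. A matrix $M_H=(m_{uv})_{u,v\in V(H)}$ is unit-compatible if for every unit $W_E$ and all $u,v\in W_E$: $m_{uw}=m_{vw}$ and $m_{wu}=m_{wv}$ for all $w\in V(H)\setminus\{u,v\}$, $m_{uu}=m_{vv}$, and $m_{uv}=m_{vu}$. For such $M_H$ and a unit $W_E$, $d_{M_H}(W_E)$ denotes the common diagonal value $m_{uu}$, $u\in W_E$, and $r_{M_H}(W_E)$ denotes the common value $m_{uv}$ for distinct $u,v\in W_E$. -}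

module Defs where

open import Level using (Level; _⊔_; suc)
open import Data.Nat using (ℕ; _∸_; _<_)
import Data.Nat as ℕ
open import Data.Fin using (Fin)
open import Data.Fin.Subset using (Subset; ∣_∣; Nonempty)
open import Data.Bool using (Bool)
import Data.Bool.Properties as Boolₚ
open import Data.List using (List)
open import Data.List.Relation.Unary.All using (All; all?)
open import Data.List.Relation.Unary.Unique.Propositional using (Unique)
open import Data.Vec using (lookup; tabulate)
open import Data.Product using (Σ; ∃; _×_)
open import Relation.Nullary using (¬_; Dec)
open import Relation.Nullary.Decidable using (isYes)
open import Relation.Binary.PropositionalEquality using (_≡_)
open import Algebra.Bundles using (CommutativeRing)

record Field (c ℓ : Level) : Set (suc (c ⊔ ℓ)) where
  field
    commutativeRing : CommutativeRing c ℓ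
  open CommutativeRing commutativeRing public
  field
    1≉0     : ¬ (1# ≈ 0#)
    inverse : ∀ x → ¬ (x ≈ 0#) → Σ Carrier λ y → x * y ≈ 1#

record Hypergraph : Set where
  field
    n          : ℕ
    nonemptyV  : 0 < n
    edges      : List (Subset n)
    edgesNonempty : All Nonempty edges
    edgesUnique   : Unique edges

module _ (H : Hypergraph) where
  open Hypergraph H

  -- E_u(H) = E_v(H): every edge contains u iff it contains v.
  SameStar : Fin n → Fin n → Set
  SameStar u v = All (λ e → lookup e u ≡ lookup e v) edges

  sameStar? : ∀ u v → Dec (SameStar u v)
  sameStar? u v = all? (λ e → lookup e u Boolₚ.≟ lookup e v) edges

  -- The unit containing w (the equivalence class of w), as a subset.
  unitOf : Fin n → Subset n
  unitOf w = tabulate λ u → isYes (sameStar? u w)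

module LinAlg {c ℓ : Level} (K : Field c ℓ) where
  open Field K

  Vector : ℕ → Set c
  Vector n = Fin n → Carrier

  Matrix : ℕ → Set c
  Matrix n = Fin n → Fin n → Carrier

  Σ[_] : ∀ {n} → (Fin n → Carrier) → Carrier
  Σ[_] {ℕ.zero}  f = 0#
  Σ[_] {ℕ.suc n} f = f Fin.zero + Σ[_] (λ i → f (Fin.suc i))

  _·_ : ∀ {n} → Matrix n → Vector n → Vector n
  (M · v) i = Σ[ (λ j → M i j * v j) ]

  InEigenspace : ∀ {n} → Matrix n → Carrier → Vector n → Set ℓ
  InEigenspace M λ′ v = ∀ i → (M · v) i ≈ λ′ * v i

  NonzeroVec : ∀ {n} → Vector n → Set ℓ
  NonzeroVec v = ∃ λ i → ¬ (v i ≈ 0#)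

  IsEigenvalue : ∀ {n} → Matrix n → Carrier → Set (c ⊔ ℓ)
  IsEigenvalue M λ′ = ∃ λ v → NonzeroVec v × InEigenspace M λ′ v

  LinearlyIndependent : ∀ {n k} → (Fin k → Vector n) → Set (c ⊔ ℓ)
  LinearlyIndependent {n} {k} vs =
    ∀ (a : Fin k → Carrier) →
      (∀ i → Σ[ (λ j → a j * vs j i) ] ≈ 0#) → ∀ j → a j ≈ 0#

  EigenspaceDimAtLeast : ∀ {n} → Matrix n → Carrier → ℕ → Set (c ⊔ ℓ)
  EigenspaceDimAtLeast {n} M λ′ d =
    ∃ λ (vs : Fin d → Vector n) →
      (∀ j → InEigenspace M λ′ (vs j)) × LinearlyIndependent vs

  UnitCompatible : (H : Hypergraph) → Matrix (Hypergraph.n H) → Set ℓ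
  UnitCompatible H M =
    ∀ u v → SameStar H u v →
      (∀ w → ¬ (w ≡ u) → ¬ (w ≡ v) → (M u w ≈ M v w) × (M w u ≈ M w v))
      × (M u u ≈ M v v) × (M u v ≈ M v u)

{-# OPTIONS --safe #-}
-- If u and v lie in a common unit, M is invariant under exchanging the rows
-- and the columns u and v, so e u - e v is an eigenvector with eigenvalue
-- m_uu - m_uv, and this value does not depend on the chosen pair of the unit.
-- Fixing w in the unit W, the |W| - 1 vectors e w - e a (a ∈ W, a ≠ w) are
-- linearly independent: the coordinate a is nonzero in exactly one of them.
module Submission where

open import Defs
open import Data.Nat using (_∸_; _<_)
open import Data.Fin.Subset using (∣_∣; _∈_)
open import Data.Product using (_×_)
open import Relation.Nullary using (¬_)
open import Relation.Binary.PropositionalEquality using (_≡_)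
open import Level using (Level)

open import Data.Nat as ℕ using (suc)
open import Data.Fin using (Fin; zero; suc; _≟_)
open import Data.Fin.Properties using (suc-injective)
open import Data.Fin.Subset using (Subset; _∉_; _─_; ⁅_⁆; inside; outside)
open import Data.Fin.Subset.Properties using (p─⊥≡p; p─q⊆p)
open import Data.Vec using (_∷_; here; there)
open import Data.Vec.Properties using (lookup∘tabulate; []=⇒lookup; lookup⇒[]=)
open import Data.Bool using (if_then_else_)
open import Data.Bool.Properties using (T-≡)
open import Data.Product using (_,_; proj₁; proj₂)
open import Data.List.Relation.Unary.All as All using ()
open import Function using (_∘_; Injective; Equivalence)
open import Relation.Nullary using (does; yes; no)
open import Relation.Nullary.Decidable using (dec-true; dec-false; toWitness; fromWitness)
open import Relation.Binary.PropositionalEquality as ≡ using (refl; cong)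

enumerate : ∀ {n} (p : Subset n) → Fin ∣ p ∣ → Fin n
enumerate (inside  ∷ p) zero    = zero
enumerate (inside  ∷ p) (suc j) = suc (enumerate p j)
enumerate (outside ∷ p) j       = suc (enumerate p j)

enumerate-∈ : ∀ {n} (p : Subset n) j → enumerate p j ∈ p
enumerate-∈ (inside  ∷ p) zero    = here
enumerate-∈ (inside  ∷ p) (suc j) = there (enumerate-∈ p j)
enumerate-∈ (outside ∷ p) j       = there (enumerate-∈ p j)

enumerate-injective : ∀ {n} (p : Subset n) → Injective _≡_ _≡_ (enumerate p)
enumerate-injective (inside  ∷ p) {zero}  {zero}  _  = refl
enumerate-injective (inside  ∷ p) {suc i} {suc j} eq =
  cong suc (enumerate-injective p (suc-injective eq))
enumerate-injective (outside ∷ p) eq = enumerate-injective p (suc-injective eq)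

x∉p─⁅x⁆ : ∀ {n} (p : Subset n) x → x ∉ p ─ ⁅ x ⁆
x∉p─⁅x⁆ (_ ∷ p) zero    ()
x∉p─⁅x⁆ (_ ∷ p) (suc x) (there x∈p─x) = x∉p─⁅x⁆ p x x∈p─x

x∈p─⁅y⁆⇒x≢y : ∀ {n} {p : Subset n} {x y} → x ∈ p ─ ⁅ y ⁆ → ¬ x ≡ y
x∈p─⁅y⁆⇒x≢y {p = p} x∈p─x refl = x∉p─⁅x⁆ p _ x∈p─x

x∈p⇒suc∣p─⁅x⁆∣≡∣p∣ : ∀ {n} {p : Subset n} {x} → x ∈ p → suc ∣ p ─ ⁅ x ⁆ ∣ ≡ ∣ p ∣
x∈p⇒suc∣p─⁅x⁆∣≡∣p∣ {p = inside  ∷ p} here        = cong (suc ∘ ∣_∣) (p─⊥≡p p)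
x∈p⇒suc∣p─⁅x⁆∣≡∣p∣ {p = inside  ∷ p} (there x∈p) = cong suc (x∈p⇒suc∣p─⁅x⁆∣≡∣p∣ x∈p)
x∈p⇒suc∣p─⁅x⁆∣≡∣p∣ {p = outside ∷ p} (there x∈p) = x∈p⇒suc∣p─⁅x⁆∣≡∣p∣ x∈p

module _ (H : Hypergraph) where
  open Hypergraph H

  sameStar-refl : ∀ u → SameStar H u u
  sameStar-refl u = All.universal (λ _ → refl) edges

  sameStar-sym : ∀ {u v} → SameStar H u v → SameStar H v u
  sameStar-sym = All.map ≡.sym

  sameStar-trans : ∀ {u v x} → SameStar H u v → SameStar H v x → SameStar H u x
  sameStar-trans u~v v~x = All.zipWith (λ (p , q) → ≡.trans p q) (u~v , v~x)

  ∈unitOf⇒sameStar : ∀ {u w} → u ∈ unitOf H w → SameStar H u w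
  ∈unitOf⇒sameStar {u} {w} u∈w = toWitness (Equivalence.from T-≡
    (≡.trans (≡.sym (lookup∘tabulate _ u)) ([]=⇒lookup u∈w)))

  sameStar⇒∈unitOf : ∀ {u w} → SameStar H u w → u ∈ unitOf H w
  sameStar⇒∈unitOf {u} {w} u~w = lookup⇒[]= u _
    (≡.trans (lookup∘tabulate _ u) (Equivalence.to T-≡ (fromWitness u~w)))

module Eigenvectors {c ℓ : Level} (K : Field c ℓ) where
  open Field K hiding (zero) renaming (refl to ≈-refl)
  open LinAlg K
  open import Algebra.Properties.Ring ring using (x[y-z]≈xy-xz; -‿distribʳ-*)
  open import Algebra.Properties.AbelianGroup +-abelianGroup
    using (⁻¹-anti-homo‿-; ⁻¹-∙-comm; ε⁻¹≈ε; ⁻¹-injective; x≈y⇒x∙y⁻¹≈ε)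
  open import Algebra.Properties.CommutativeSemigroup +-commutativeSemigroup
    using (interchange)
  open import Relation.Binary.Reasoning.Setoid setoid

  x-0#≈x : ∀ x → x - 0# ≈ x
  x-0#≈x x = trans (+-congˡ ε⁻¹≈ε) (+-identityʳ x)

  Σ-cong : ∀ {n} {f g : Fin n → Carrier} → (∀ i → f i ≈ g i) → Σ[ f ] ≈ Σ[ g ]
  Σ-cong {ℕ.zero} f≈g = ≈-refl
  Σ-cong {suc n}  f≈g = +-cong (f≈g zero) (Σ-cong (f≈g ∘ suc))

  Σ-zero : ∀ {n} {f : Fin n → Carrier} → (∀ i → f i ≈ 0#) → Σ[ f ] ≈ 0#
  Σ-zero {ℕ.zero} f≈0 = ≈-refl
  Σ-zero {suc n}  f≈0 = trans (+-cong (f≈0 zero) (Σ-zero (f≈0 ∘ suc))) (+-identityˡ 0#)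

  Σ-distrib-- : ∀ {n} (f g : Fin n → Carrier) → Σ[ (λ i → f i - g i) ] ≈ Σ[ f ] - Σ[ g ]
  Σ-distrib-- {ℕ.zero} f g = sym (x-0#≈x 0#)
  Σ-distrib-- {suc n}  f g = begin
    (f zero - g zero) + Σ[ (λ i → f (suc i) - g (suc i)) ]
      ≈⟨ +-congˡ (Σ-distrib-- (f ∘ suc) (g ∘ suc)) ⟩
    (f zero - g zero) + (Σ[ f ∘ suc ] - Σ[ g ∘ suc ])
      ≈⟨ interchange _ _ _ _ ⟩
    (f zero + Σ[ f ∘ suc ]) + (- g zero - Σ[ g ∘ suc ])
      ≈⟨ +-congˡ (⁻¹-∙-comm _ _) ⟩
    Σ[ f ] - Σ[ g ] ∎

  Σ-supported : ∀ {n} (f : Fin n → Carrier) k → (∀ j → ¬ j ≡ k → f j ≈ 0#) → Σ[ f ] ≈ f k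
  Σ-supported f zero f≈0 =
    trans (+-congˡ (Σ-zero (λ j → f≈0 (suc j) λ ()))) (+-identityʳ _)
  Σ-supported f (suc k) f≈0 =
    trans (+-cong (f≈0 zero λ ())
                  (Σ-supported (f ∘ suc) k (λ j j≢k → f≈0 (suc j) (j≢k ∘ suc-injective))))
          (+-identityˡ _)

  e : ∀ {n} → Fin n → Vector n
  e a i = if does (a ≟ i) then 1# else 0#

  e-same : ∀ {n} (a : Fin n) → e a a ≈ 1#
  e-same a = reflexive (cong (if_then 1# else 0#) (dec-true (a ≟ a) refl))

  e-other : ∀ {n} {a i : Fin n} → ¬ i ≡ a → e a i ≈ 0#
  e-other {a = a} {i} i≢a = reflexive (cong (if_then 1# else 0#) (dec-false (a ≟ i) (i≢a ∘ ≡.sym)))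

  _⊖_ : ∀ {n} → Vector n → Vector n → Vector n
  (x ⊖ y) i = x i - y i

  e⊖e-left : ∀ {n} {u v : Fin n} → ¬ u ≡ v → (e u ⊖ e v) u ≈ 1#
  e⊖e-left {u = u} u≢v = trans (+-cong (e-same u) (-‿cong (e-other u≢v))) (x-0#≈x 1#)

  e⊖e-right : ∀ {n} {u v : Fin n} → ¬ u ≡ v → (e u ⊖ e v) v ≈ - 1#
  e⊖e-right {v = v} u≢v =
    trans (+-cong (e-other (u≢v ∘ ≡.sym)) (-‿cong (e-same v))) (+-identityˡ _)

  e⊖e-other : ∀ {n} {u v i : Fin n} → ¬ i ≡ u → ¬ i ≡ v → (e u ⊖ e v) i ≈ 0#
  e⊖e-other i≢u i≢v = trans (+-cong (e-other i≢u) (-‿cong (e-other i≢v))) (-‿inverseʳ 0#)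

  e⊖e-nonzero : ∀ {n} {u v : Fin n} → ¬ u ≡ v → NonzeroVec (e u ⊖ e v)
  e⊖e-nonzero {u = u} u≢v = u , λ e⊖e≈0 → 1≉0 (trans (sym (e⊖e-left u≢v)) e⊖e≈0)

  ·-distrib-⊖ : ∀ {n} (M : Matrix n) x y i → (M · (x ⊖ y)) i ≈ (M · x) i - (M · y) i
  ·-distrib-⊖ M x y i =
    trans (Σ-cong (λ j → x[y-z]≈xy-xz (M i j) (x j) (y j)))
          (Σ-distrib-- (λ j → M i j * x j) (λ j → M i j * y j))

  ·-e : ∀ {n} (M : Matrix n) a i → (M · e a) i ≈ M i a
  ·-e M a i = begin
    Σ[ (λ j → M i j * e a j) ] ≈⟨ Σ-supported _ a (λ j j≢a → trans (*-congˡ (e-other j≢a)) (zeroʳ _)) ⟩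
    M i a * e a a              ≈⟨ *-congˡ (e-same a) ⟩
    M i a * 1#                 ≈⟨ *-identityʳ _ ⟩
    M i a                      ∎

  ·-e⊖e : ∀ {n} (M : Matrix n) u v i → (M · (e u ⊖ e v)) i ≈ M i u - M i v
  ·-e⊖e M u v i = trans (·-distrib-⊖ M (e u) (e v) i) (+-cong (·-e M u i) (-‿cong (·-e M v i)))

  InEigenspace-resp-≈ : ∀ {n} {M : Matrix n} {λ₁ λ₂ x} →
                        λ₁ ≈ λ₂ → InEigenspace M λ₁ x → InEigenspace M λ₂ x
  InEigenspace-resp-≈ λ₁≈λ₂ x∈E i = trans (x∈E i) (*-congʳ λ₁≈λ₂)

  -- UnitCompatible H M unfolds to ∀ u v → SameStar H u v → Twins M u v.
  Twins : ∀ {n} → Matrix n → Fin n → Fin n → Set ℓ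
  Twins M u v =
    (∀ w → ¬ w ≡ u → ¬ w ≡ v → (M u w ≈ M v w) × (M w u ≈ M w v))
    × (M u u ≈ M v v) × (M u v ≈ M v u)

  twins⇒eigenvector : ∀ {n} {M : Matrix n} {u v} → Twins M u v → ¬ u ≡ v →
                      InEigenspace M (M u u - M u v) (e u ⊖ e v)
  twins⇒eigenvector {M = M} {u} {v} (columns , diagonal , offDiagonal) u≢v i
    with i ≟ u | i ≟ v
  ... | yes refl | _ = begin
    (M · (e u ⊖ e v)) u          ≈⟨ ·-e⊖e M u v u ⟩
    M u u - M u v                ≈⟨ *-identityʳ _ ⟨
    (M u u - M u v) * 1#         ≈⟨ *-congˡ (e⊖e-left u≢v) ⟨
    (M u u - M u v) * (e u ⊖ e v) u ∎
  ... | no _ | yes refl = begin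
    (M · (e u ⊖ e v)) v          ≈⟨ ·-e⊖e M u v v ⟩
    M v u - M v v                ≈⟨ +-cong offDiagonal (-‿cong diagonal) ⟨
    M u v - M u u                ≈⟨ ⁻¹-anti-homo‿- _ _ ⟨
    - (M u u - M u v)            ≈⟨ -‿cong (*-identityʳ _) ⟨
    - ((M u u - M u v) * 1#)     ≈⟨ -‿distribʳ-* _ _ ⟩
    (M u u - M u v) * - 1#       ≈⟨ *-congˡ (e⊖e-right u≢v) ⟨
    (M u u - M u v) * (e u ⊖ e v) v ∎
  ... | no i≢u | no i≢v = begin
    (M · (e u ⊖ e v)) i          ≈⟨ ·-e⊖e M u v i ⟩
    M i u - M i v                ≈⟨ x≈y⇒x∙y⁻¹≈ε (proj₂ (columns i i≢u i≢v)) ⟩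
    0#                           ≈⟨ zeroʳ _ ⟨
    (M u u - M u v) * 0#         ≈⟨ *-congˡ (e⊖e-other i≢u i≢v) ⟨
    (M u u - M u v) * (e u ⊖ e v) i ∎

  e⊖e-linearlyIndependent : ∀ {n k} {w : Fin n} {f : Fin k → Fin n} →
                            Injective _≡_ _≡_ f → (∀ j → ¬ f j ≡ w) →
                            LinearlyIndependent (λ j → e w ⊖ e (f j))
  e⊖e-linearlyIndependent {w = w} {f} f-injective f≢w α combination≈0 k =
    ⁻¹-injective (begin
      - α k                                ≈⟨ -‿cong (*-identityʳ _) ⟨
      - (α k * 1#)                         ≈⟨ -‿distribʳ-* _ _ ⟩
      α k * - 1#                           ≈⟨ *-congˡ (e⊖e-right (f≢w k ∘ ≡.sym)) ⟨
      α k * (e w ⊖ e (f k)) (f k)          ≈⟨ Σ-supported _ k vanishes ⟨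
      Σ[ (λ j → α j * (e w ⊖ e (f j)) (f k)) ] ≈⟨ combination≈0 (f k) ⟩
      0#                                   ≈⟨ ε⁻¹≈ε ⟨
      - 0#                                 ∎)
    where
    vanishes : ∀ j → ¬ j ≡ k → α j * (e w ⊖ e (f j)) (f k) ≈ 0#
    vanishes j j≢k =
      trans (*-congˡ (e⊖e-other (f≢w k) (j≢k ∘ ≡.sym ∘ f-injective))) (zeroʳ _)

  module _ (H : Hypergraph) (M : Matrix (Hypergraph.n H)) (uc : UnitCompatible H M) where

    unit-offDiagonal-constant : ∀ {a u w} → SameStar H a u → ¬ a ≡ w → ¬ u ≡ w →
                                M w a ≈ M w u
    unit-offDiagonal-constant {a} {u} a~u a≢w u≢w with a ≟ u
    ... | yes refl = ≈-refl
    ... | no a≢u = proj₂ (proj₁ (uc a u a~u) _ (a≢w ∘ ≡.sym) (u≢w ∘ ≡.sym))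

    unit-eigenvector : ∀ {w u a} → u ∈ unitOf H w → ¬ u ≡ w →
                       a ∈ unitOf H w → ¬ a ≡ w →
                       InEigenspace M (M w w - M w u) (e w ⊖ e a)
    unit-eigenvector {w} u∈W u≢w a∈W a≢w =
      InEigenspace-resp-≈ (+-congˡ (-‿cong (unit-offDiagonal-constant a~u a≢w u≢w)))
        (twins⇒eigenvector (uc w _ (sameStar-sym H a~w)) (a≢w ∘ ≡.sym))
      where
      a~w = ∈unitOf⇒sameStar H a∈W
      a~u = sameStar-trans H a~w (sameStar-sym H (∈unitOf⇒sameStar H u∈W))

    unit-eigenspace : ∀ {w u} → u ∈ unitOf H w → ¬ u ≡ w →
                      EigenspaceDimAtLeast M (M w w - M w u) ∣ unitOf H w ─ ⁅ w ⁆ ∣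
    unit-eigenspace {w} u∈W u≢w =
      (λ j → e w ⊖ e (a j)) ,
      (λ j → unit-eigenvector u∈W u≢w (p─q⊆p _ _ (enumerate-∈ W-w j)) (a≢w j)) ,
      e⊖e-linearlyIndependent (enumerate-injective W-w) a≢w
      where
      W-w = unitOf H w ─ ⁅ w ⁆
      a = enumerate W-w
      a≢w : ∀ j → ¬ a j ≡ w
      a≢w j = x∈p─⁅y⁆⇒x≢y (enumerate-∈ W-w j)

mainTheorem13 : ∀ {c ℓ : Level} (K : Field c ℓ) (H : Hypergraph)
    (M : LinAlg.Matrix K (Hypergraph.n H)) →
    LinAlg.UnitCompatible K H M →
    ∀ w → 1 < ∣ unitOf H w ∣ →
    ∀ u → u ∈ unitOf H w → ¬ (u ≡ w) →
    LinAlg.IsEigenvalue K M (Field._-_ K (M w w) (M w u))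
    × LinAlg.EigenspaceDimAtLeast K M (Field._-_ K (M w w) (M w u)) (∣ unitOf H w ∣ ∸ 1)
-- The hypothesis 1 < ∣ unitOf H w ∣ is implied by the existence of u.
mainTheorem13 K H M uc w _ u u∈W u≢w =
  (e w ⊖ e u , e⊖e-nonzero (u≢w ∘ ≡.sym) , unit-eigenvector H M uc u∈W u≢w u∈W u≢w) ,
  ≡.subst (EigenspaceDimAtLeast M _) ∣W─w∣≡∣W∣∸1 (unit-eigenspace H M uc u∈W u≢w)
  where
  open LinAlg K
  open Eigenvectors K
  ∣W─w∣≡∣W∣∸1 : ∣ unitOf H w ─ ⁅ w ⁆ ∣ ≡ ∣ unitOf H w ∣ ∸ 1
  ∣W─w∣≡∣W∣∸1 = cong (_∸ 1) (x∈p⇒suc∣p─⁅x⁆∣≡∣p∣ (sameStar⇒∈unitOf H (sameStar-refl H w)))
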